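{- Let $\mathcal{P}$ be the conjunction of population protocols $\mathcal{P}_1$ and $\mathcal{P}_2$ (defined in the context). For all configurations $C, C'$ of $\mathcal{P}$, every $x : S \to \mathbb{N}$ and every $i \in \{1,2\}$: if $C'$ is potentially reachable from $C$ through $x$ in $\mathcal{P}$, then $\pi_i(C')$ is potentially reachable from $\pi_i(C)$ through $\pi_i(x)$ in $\mathcal{P}_i$.
   Context: A population over finite $E$ is $M : E \to \mathbb{N}$ with $\sum_e M(e)\ge 2$. A population protocol is $(Q,T,\Sigma,I,O)$ with $T\subseteq Q^2\times Q^2$ containing for each $(p,q)$ some $(p,q,p',q')$, $I:\Sigma\to Q$, $O:Q\to\{0,1\}$; configurations are populations over $Q$; for $t=(p,q,p',q')$, written $(p,q)\mapsto(p',q')$, $\mathrm{pre}(t)$, $\mathrm{post}(t)$ are the multisets $\{p,q\}$, $\{p',q'\}$. Let $\mathcal{P}_1 = (Q_1,T_1,\Sigma,I_1,O_1)$, $\mathcal{P}_2 = (Q_2,T_2,\Sigma,I_2,O_2)$. Their conjunction is $\mathcal{P} = (Q_1\times Q_2, S, \Sigma, I, O)$ with $I(\sigma) = (I_1(\sigma), I_2(\sigma))$, $O(p,q) = O_1(p)\wedge O_2(q)$, $S = S_1\cup S_2$, $S_1 = \{((p,r),(p',r'))\mapsto((q,r),(q',r')) : (p,p',q,q')\in T_1,\ r,r'\in Q_2\}$, $S_2 = \{((r,p),(r',p'))\mapsto((r,q),(r',q')) : (p,p',q,q')\in T_2,\ r,r'\in Q_1\}$. Projections: $\pi_i(q_1,q_2)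 = q_i$; for $s = (p,q,p',q') \in S_i$, $\pi_i(s) = (\pi_i(p),\pi_i(q),\pi_i(p'),\pi_i(q')) \in T_i$; for a configuration $C$ of $\mathcal{P}$, $\pi_i(C)(q) = \sum_{r : \pi_i(r) = q} C(r)$; for $x : S\to\mathbb{N}$, $\pi_i(x)(t) = \sum_{s\in S_i : \pi_i(s) = t} x(s)$ for $t\in T_i$. Potential reachability in a protocol with states $Q$ and transitions $T$: for $C,C'$ and $x : T\to\mathbb{N}$, flow equations are $C'(q) = C(q)+\sum_t x(t)(\mathrm{post}(t)(q)-\mathrm{pre}(t)(q))$ for all $q$. For $R\subseteq Q$: ${}^\bullet R = \{t : \mathrm{supp}(\mathrm{post}(t))\cap R\ne\emptyset\}$, $R^\bullet = \{t:\mathrm{supp}(\mathrm{pre}(t))\cap R\neq\emptyset\}$, $C(R) = \sum_{q\in R}C(q)$. For $U\subseteq T$, $P$ is a $U$-trap if $P^\bullet\cap U\subseteq{}^\bullet P$, a $U$-siphon if ${}^\bullet P\cap U\subseteq P^\bullet$. $C'$ is potentially reachable from $C$ through $x$ if, with $U=\mathrm{supp}(x)$, the flow equations hold, $C'(P) = 0\Rightarrow {}^\bullet P\cap U=\emptyset$ for every $U$-trap $P$, and $C(P)=0\Rightarrow P^\bullet\cap U = \emptyset$ for every $U$-siphon $P$. -}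

module Defs where

open import Data.Bool using (Bool; true; false; _∧_; if_then_else_)
open import Data.Nat using (ℕ; zero; suc; _≤_)
open import Data.Integer as ℤ using (ℤ; +_)
open import Data.List using (List; map; foldr; cartesianProduct)
open import Data.Nat.ListAction using (sum)
open import Data.List.Membership.Propositional using (_∈_)
open import Data.List.Membership.Propositional.Properties using (∈-cartesianProduct⁺)
open import Data.List.Relation.Unary.Unique.Propositional using (Unique)
import Data.List.Relation.Unary.Unique.Propositional.Properties as UniqueP
open import Data.Product using (∃; ∃-syntax; _×_; _,_; proj₁; proj₂)
open import Data.Product.Properties using (≡-dec)
open import Data.Sum using (_⊎_)
open import Relation.Binary.PropositionalEquality using (_≡_; _≢_)
open import Relation.Binary.Definitions using (DecidableEquality)
open import Relation.Nullary.Decidable using (⌊_⌋; yes; no)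
open import Relation.Nullary using (¬_)
open import Relation.Binary.PropositionalEquality using (refl; cong)
open import Data.Bool using (_∨_)
open import Data.Fin using (Fin)
import Data.Fin as F
open import Data.Empty using (⊥-elim)

record FinType : Set₁ where
  field
    Carrier  : Set
    _≟_      : DecidableEquality Carrier
    enum     : List Carrier
    complete : ∀ a → a ∈ enum
    unique   : Unique enum

open FinType public

_×ᶠ_ : FinType → FinType → FinType
A ×ᶠ B = record
  { Carrier  = Carrier A × Carrier B
  ; _≟_      = ≡-dec (_≟_ A) (_≟_ B)
  ; enum     = cartesianProduct (enum A) (enum B)
  ; complete = λ { (a , b) → ∈-cartesianProduct⁺ (complete A a) (complete B b) }
  ; unique   = UniqueP.cartesianProduct⁺ (unique A) (unique B)
  }

sumF : (E : FinType) → (Carrier E → ℕ) → ℕ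
sumF E f = sum (map f (enum E))

sumℤ : (E : FinType) → (Carrier E → ℤ) → ℤ
sumℤ E f = foldr ℤ._+_ (+ 0) (map f (enum E))

eqb : (E : FinType) → Carrier E → Carrier E → Bool
eqb E a b = ⌊ _≟_ E a b ⌋

IsPopulation : (E : FinType) → (Carrier E → ℕ) → Set
IsPopulation E M = 2 ≤ sumF E M

-- Population protocols.
-- Quadruples (p , q , p' , q') encode (p , q) ↦ (p' , q').
-- The transition set T ⊆ Q² × Q² is given by its characteristic function.

Quad : Set → Set
Quad Q = Q × Q × Q × Q

record Protocol (Σ : Set) : Set₁ where
  field
    Q     : FinType
    T     : Quad (Carrier Q) → Bool
    total : ∀ p q → ∃[ p' ] ∃[ q' ] (T (p , q , p' , q') ≡ true)
    I     : Σ → Carrier Q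
    O     : Carrier Q → Bool

open Protocol public

QuadF : FinType → FinType
QuadF Q = Q ×ᶠ (Q ×ᶠ (Q ×ᶠ Q))

count : (E : FinType) → Carrier E → Carrier E → ℕ
count E a r = if eqb E a r then 1 else 0

pre : (E : FinType) → Quad (Carrier E) → Carrier E → ℕ
pre E (p , q , p' , q') r = count E p r Data.Nat.+ count E q r

post : (E : FinType) → Quad (Carrier E) → Carrier E → ℕ
post E (p , q , p' , q') r = count E p' r Data.Nat.+ count E q' r

-- Potential reachability in a protocol P.
-- A vector x : T → ℕ is represented as a function on all quadruples
-- that vanishes outside T.

module _ {Σ : Set} (P : Protocol Σ) where
  private
    E  = Q P
    St = Carrier E
    Tr = Quad St

  Config : Set
  Config = St → ℕ

  IsTransVec : (Tr → ℕ) → Set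
  IsTransVec x = ∀ t → T P t ≡ false → x t ≡ 0

  Subset : Set
  Subset = St → Bool

  _∈•_ : Tr → Subset → Set
  (p , q , p' , q') ∈• R = R p' ≡ true ⊎ R q' ≡ true

  _∈_• : Tr → Subset → Set
  (p , q , p' , q') ∈ R • = R p ≡ true ⊎ R q ≡ true

  InSupp : (Tr → ℕ) → Tr → Set
  InSupp x t = x t ≢ 0

  mass : Config → Subset → ℕ
  mass C R = sumF E (λ q → if R q then C q else 0)

  IsTrap : (Tr → ℕ) → Subset → Set
  IsTrap x R = ∀ t → t ∈ R • → InSupp x t → t ∈• R

  IsSiphon : (Tr → ℕ) → Subset → Set
  IsSiphon x R = ∀ t → t ∈• R → InSupp x t → t ∈ R •

  FlowEquations : Config → Config → (Tr → ℕ) → Set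
  FlowEquations C C' x = ∀ q →
    + C' q ≡ + C q ℤ.+ sumℤ (QuadF E)
                         (λ t → + x t ℤ.* (+ post E t q ℤ.- + pre E t q))

  PotentiallyReachable : Config → Config → (Tr → ℕ) → Set
  PotentiallyReachable C C' x =
    FlowEquations C C' x
    × (∀ R → IsTrap x R → mass C' R ≡ 0 → ∀ t → t ∈• R → ¬ InSupp x t)
    × (∀ R → IsSiphon x R → mass C R ≡ 0 → ∀ t → t ∈ R • → ¬ InSupp x t)

eqb-refl : (E : FinType) → ∀ a → eqb E a a ≡ true
eqb-refl E a with _≟_ E a a
... | yes _ = refl
... | no ¬p = ⊥-elim (¬p refl)

module Conj {Σ : Set} (P₁ P₂ : Protocol Σ) where
  private
    Q₁ = Q P₁
    Q₂ = Q P₂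
    A₁ = Carrier Q₁
    A₂ = Carrier Q₂

  QC : FinType
  QC = Q₁ ×ᶠ Q₂

  S₁ : Quad (A₁ × A₂) → Bool
  S₁ ((a₁ , a₂) , (b₁ , b₂) , (c₁ , c₂) , (d₁ , d₂)) =
    T P₁ (a₁ , b₁ , c₁ , d₁) ∧ (eqb Q₂ a₂ c₂ ∧ eqb Q₂ b₂ d₂)

  S₂ : Quad (A₁ × A₂) → Bool
  S₂ ((a₁ , a₂) , (b₁ , b₂) , (c₁ , c₂) , (d₁ , d₂)) =
    T P₂ (a₂ , b₂ , c₂ , d₂) ∧ (eqb Q₁ a₁ c₁ ∧ eqb Q₁ b₁ d₁)

  S : Quad (A₁ × A₂) → Bool
  S s = S₁ s ∨ S₂ s

  total-S : ∀ p q → ∃[ p' ] ∃[ q' ] (S (p , q , p' , q') ≡ true)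
  total-S (p₁ , p₂) (q₁ , q₂) with total P₁ p₁ q₁
  ... | p₁' , q₁' , h = (p₁' , p₂) , (q₁' , q₂) , eq
    where
      eq : S ((p₁ , p₂) , (q₁ , q₂) , (p₁' , p₂) , (q₁' , q₂)) ≡ true
      eq rewrite h | eqb-refl Q₂ p₂ | eqb-refl Q₂ q₂ = refl

  conj : Protocol Σ
  conj = record
    { Q     = QC
    ; T     = S
    ; total = total-S
    ; I     = λ σ → (I P₁ σ , I P₂ σ)
    ; O     = λ { (p , q) → O P₁ p ∧ O P₂ q }
    }

  πQuad₁ : Quad (A₁ × A₂) → Quad A₁
  πQuad₁ ((a₁ , _) , (b₁ , _) , (c₁ , _) , (d₁ , _)) = (a₁ , b₁ , c₁ , d₁)

  πQuad₂ : Quad (A₁ × A₂) → Quad A₂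
  πQuad₂ ((_ , a₂) , (_ , b₂) , (_ , c₂) , (_ , d₂)) = (a₂ , b₂ , c₂ , d₂)

  comp : Fin 2 → Protocol Σ
  comp F.zero = P₁
  comp (F.suc _) = P₂

  πState : (i : Fin 2) → A₁ × A₂ → Carrier (Q (comp i))
  πState F.zero = proj₁
  πState (F.suc _) = proj₂

  πTrans : (i : Fin 2) → Quad (A₁ × A₂) → Quad (Carrier (Q (comp i)))
  πTrans F.zero = πQuad₁
  πTrans (F.suc _) = πQuad₂

  Sᵢ : Fin 2 → Quad (A₁ × A₂) → Bool
  Sᵢ F.zero = S₁
  Sᵢ (F.suc _) = S₂

  πConfig : (i : Fin 2) → Config conj → Config (comp i)
  πConfig i C q = sumF QC (λ r → if eqb (Q (comp i)) (πState i r) q then C r else 0)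

  πVec : (i : Fin 2) → (Quad (A₁ × A₂) → ℕ) → Quad (Carrier (Q (comp i))) → ℕ
  πVec i x t = sumF (QuadF QC)
    (λ s → if Sᵢ i s ∧ eqb (QuadF (Q (comp i))) (πTrans i s) t then x s else 0)

-- Project everything along πᵢ. A transition of the conjunction either acts on
-- component i, and then projects to a transition of Pᵢ, or it fixes component i,
-- and then its projected effect vanishes. Pushing the flow equations forward
-- along πᵢ therefore gives the flow equations of Pᵢ for πᵢ(x). For the trap and
-- siphon conditions, the preimage πᵢ⁻¹(R) of a πᵢ(x)-trap (siphon) R of Pᵢ is an
-- x-trap (siphon) of the conjunction, with C(πᵢ⁻¹(R)) = πᵢ(C)(R), and a
-- transition t of Pᵢ touching R has πᵢ(x)(t) = 0 as soon as every transition of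
-- the conjunction projecting to t is outside supp(x).
module Submission where

open import Defs
open import Data.Bool using (Bool; true; false; _∧_; _∨_; if_then_else_)
open import Data.Bool.Properties using (∧-zeroʳ; ∨-identityʳ)
open import Data.Empty using (⊥-elim)
open import Data.Fin using (Fin; zero; suc)
open import Data.Integer using (ℤ; +_; _+_; _*_; -_; _-_)
import Data.Integer.Properties as ℤₚ
open import Data.List using (List; []; _∷_; map; foldr)
open import Data.List.Membership.Propositional using (_∈_)
open import Data.List.Relation.Unary.All using (lookup)
open import Data.List.Relation.Unary.AllPairs using (_∷_)
open import Data.List.Relation.Unary.Any using (here; there)
open import Data.List.Relation.Unary.Unique.Propositional using (Unique)
open import Data.Nat as ℕ using (ℕ)
open import Data.Nat.ListAction using (sum)
import Data.Nat.Properties as ℕₚ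
open import Data.Product using (_×_; _,_; proj₁; proj₂)
open import Data.Sum using (_⊎_; inj₁; inj₂) renaming (map to ⊎-map)
open import Function using (_∘_)
open import Relation.Binary.PropositionalEquality
open import Relation.Nullary using (¬_; yes; no)
open import Relation.Nullary.Decidable using (decidable-stable; dec-false; isYes≗does)
open import Algebra.Properties.CommutativeSemigroup ℤₚ.+-commutativeSemigroup
  using (interchange)
open import Algebra.Properties.CommutativeSemigroup ℤₚ.*-commutativeSemigroup
  using (x∙yz≈y∙xz; xy∙z≈y∙xz)

private
  variable
    A X : Set

Σℤ : List A → (A → ℤ) → ℤ
Σℤ l f = foldr _+_ (+ 0) (map f l)

Σ-cong : (l : List A) {f g : A → ℤ} → (∀ a → f a ≡ g a) → Σℤ l f ≡ Σℤ l g
Σ-cong []      f≡g = refl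
Σ-cong (a ∷ l) f≡g = cong₂ _+_ (f≡g a) (Σ-cong l f≡g)

Σ-zero : (l : List A) (f : A → ℤ) → (∀ {a} → a ∈ l → f a ≡ + 0) → Σℤ l f ≡ + 0
Σ-zero []      f f≡0 = refl
Σ-zero (a ∷ l) f f≡0 = cong₂ _+_ (f≡0 (here refl)) (Σ-zero l f (f≡0 ∘ there))

Σ-+ : (l : List A) (f g : A → ℤ) → Σℤ l (λ a → f a + g a) ≡ Σℤ l f + Σℤ l g
Σ-+ []      f g = refl
Σ-+ (a ∷ l) f g =
  trans (cong (_+_ (f a + g a)) (Σ-+ l f g)) (interchange (f a) (g a) (Σℤ l f) (Σℤ l g))

Σ-*ˡ : (l : List A) (c : ℤ) (f : A → ℤ) → Σℤ l (λ a → c * f a) ≡ c * Σℤ l f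
Σ-*ˡ []      c f = sym (ℤₚ.*-zeroʳ c)
Σ-*ˡ (a ∷ l) c f =
  trans (cong (_+_ (c * f a)) (Σ-*ˡ l c f)) (sym (ℤₚ.*-distribˡ-+ c (f a) (Σℤ l f)))

Σ-neg : (l : List A) (f : A → ℤ) → Σℤ l (λ a → - f a) ≡ - Σℤ l f
Σ-neg []      f = refl
Σ-neg (a ∷ l) f =
  trans (cong (_+_ (- f a)) (Σ-neg l f)) (sym (ℤₚ.neg-distrib-+ (f a) (Σℤ l f)))

Σ-- : (l : List A) (f g : A → ℤ) → Σℤ l (λ a → f a - g a) ≡ Σℤ l f - Σℤ l g
Σ-- l f g = trans (Σ-+ l f (-_ ∘ g)) (cong (_+_ (Σℤ l f)) (Σ-neg l g))

Σ-swap : (l : List A) (m : List X) (f : A → X → ℤ) →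
         Σℤ l (λ a → Σℤ m (f a)) ≡ Σℤ m (λ b → Σℤ l (λ a → f a b))
Σ-swap []      m f = sym (Σ-zero m (λ _ → + 0) (λ _ → refl))
Σ-swap (a ∷ l) m f =
  trans (cong (_+_ (Σℤ m (f a))) (Σ-swap l m f)) (sym (Σ-+ m (f a) (λ b → Σℤ l (λ a → f a b))))

+-sum : (l : List A) (f : A → ℕ) → + sum (map f l) ≡ Σℤ l (λ a → + f a)
+-sum []      f = refl
+-sum (a ∷ l) f = trans (ℤₚ.pos-+ (f a) (sum (map f l))) (cong (_+_ (+ f a)) (+-sum l f))

sum≡0⇒∈≡0 : (l : List A) (f : A → ℕ) → sum (map f l) ≡ 0 → ∀ {a} → a ∈ l → f a ≡ 0
sum≡0⇒∈≡0 (b ∷ l) f sum≡0 (here refl) = ℕₚ.m+n≡0⇒m≡0 (f b) sum≡0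
sum≡0⇒∈≡0 (b ∷ l) f sum≡0 (there a∈l) = sum≡0⇒∈≡0 l f (ℕₚ.m+n≡0⇒n≡0 (f b) sum≡0) a∈l

all≡0⇒sum≡0 : (l : List A) (f : A → ℕ) → (∀ a → f a ≡ 0) → sum (map f l) ≡ 0
all≡0⇒sum≡0 []      f f≡0 = refl
all≡0⇒sum≡0 (a ∷ l) f f≡0 = cong₂ ℕ._+_ (f≡0 a) (all≡0⇒sum≡0 l f f≡0)

-- ι (eqb E a r) is definitionally + count E a r.
ι : Bool → ℤ
ι b = + (if b then 1 else 0)

+-if : ∀ b n → + (if b then n else 0) ≡ ι b * + n
+-if true  n = sym (ℤₚ.*-identityˡ (+ n))
+-if false n = refl

ι-∧ : ∀ a b → ι (a ∧ b) ≡ ι a * ι b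
ι-∧ true  b = sym (ℤₚ.*-identityˡ (ι b))
ι-∧ false b = refl

if-zero : ∀ b {n} → n ≡ 0 → (if b then n else 0) ≡ 0
if-zero true  n≡0 = n≡0
if-zero false n≡0 = refl

∧-true : ∀ a {b} → a ∧ b ≡ true → a ≡ true × b ≡ true
∧-true true b≡true = refl , b≡true

eqb-sound : (E : FinType) {a b : Carrier E} → eqb E a b ≡ true → a ≡ b
eqb-sound E {a} {b} eq with _≟_ E a b
eqb-sound E ()  | no  _
eqb-sound E _   | yes a≡b = a≡b

Σ-pick-unique : (E : FinType) {l : List (Carrier E)} → Unique l → ∀ {a} → a ∈ l →
                (f : Carrier E → ℤ) → Σℤ l (λ r → ι (eqb E a r) * f r) ≡ f a
Σ-pick-unique E {b ∷ l} (b∉l ∷ l-unique) {a} a∈bl f with _≟_ E a b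
... | yes refl = begin
  + 1 * f a + Σℤ l (λ r → ι (eqb E a r) * f r) ≡⟨ cong₂ _+_ (ℤₚ.*-identityˡ (f a)) rest≡0 ⟩
  f a + + 0                                   ≡⟨ ℤₚ.+-identityʳ (f a) ⟩
  f a                                         ∎
  where
  open ≡-Reasoning
  rest≡0 : Σℤ l (λ r → ι (eqb E a r) * f r) ≡ + 0
  rest≡0 = Σ-zero l _ λ {r} r∈l → cong (λ e → ι e * f r)
    (trans (isYes≗does (_≟_ E a r)) (dec-false (_≟_ E a r) (lookup b∉l r∈l)))
... | no a≢b = trans (ℤₚ.+-identityˡ _) (Σ-pick-unique E l-unique (tail a∈bl) f)
  where
  tail : a ∈ b ∷ l → a ∈ l
  tail (here a≡b)  = ⊥-elim (a≢b a≡b)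
  tail (there a∈l) = a∈l

Σ-pick : (E : FinType) (a : Carrier E) (f : Carrier E → ℤ) →
         sumℤ E (λ r → ι (eqb E a r) * f r) ≡ f a
Σ-pick E a = Σ-pick-unique E (unique E) (complete E a)

module Fibres (B : FinType) (h : A → Carrier B) (L : List A) where

  fibreSum : (A → ℤ) → Carrier B → ℤ
  fibreSum φ b = Σℤ L (λ a → ι (eqb B (h a) b) * φ a)

  fibreSum-cong : ∀ {φ ψ} → (∀ a → φ a ≡ ψ a) → ∀ b → fibreSum φ b ≡ fibreSum ψ b
  fibreSum-cong φ≡ψ b = Σ-cong L (λ a → cong (ι (eqb B (h a) b) *_) (φ≡ψ a))

  fibreSum-+ : ∀ φ ψ b → fibreSum (λ a → φ a + ψ a) b ≡ fibreSum φ b + fibreSum ψ b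
  fibreSum-+ φ ψ b =
    trans (Σ-cong L (λ a → ℤₚ.*-distribˡ-+ (ι (eqb B (h a) b)) (φ a) (ψ a))) (Σ-+ L _ _)

  fibreSum-- : ∀ φ ψ b → fibreSum (λ a → φ a - ψ a) b ≡ fibreSum φ b - fibreSum ψ b
  fibreSum-- φ ψ b = trans (Σ-cong L distrib) (Σ-- L _ _)
    where
    distrib : ∀ a → ι (eqb B (h a) b) * (φ a - ψ a)
                  ≡ ι (eqb B (h a) b) * φ a - ι (eqb B (h a) b) * ψ a
    distrib a = let i = ι (eqb B (h a) b) in
      trans (ℤₚ.*-distribˡ-+ i (φ a) (- ψ a)) (cong (_+_ (i * φ a)) (sym (ℤₚ.neg-distribʳ-* i (ψ a))))

  fibreSum-*ˡ : ∀ c φ b → fibreSum (λ a → c * φ a) b ≡ c * fibreSum φ b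
  fibreSum-*ˡ c φ b =
    trans (Σ-cong L (λ a → x∙yz≈y∙xz (ι (eqb B (h a) b)) c (φ a))) (Σ-*ˡ L c _)

  fibreSum-Σ : (M : List X) (ψ : X → A → ℤ) (b : Carrier B) →
               fibreSum (λ a → Σℤ M (λ s → ψ s a)) b ≡ Σℤ M (λ s → fibreSum (ψ s) b)
  fibreSum-Σ M ψ b =
    trans (Σ-cong L (λ a → sym (Σ-*ˡ M (ι (eqb B (h a) b)) (λ s → ψ s a))))
          (Σ-swap L M (λ a s → ι (eqb B (h a) b) * ψ s a))

  Σ-fibreSum : (g : Carrier B → ℤ) (φ : A → ℤ) →
               sumℤ B (λ b → g b * fibreSum φ b) ≡ Σℤ L (λ a → g (h a) * φ a)
  Σ-fibreSum g φ = begin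
    Σℤ (enum B) (λ b → g b * Σℤ L (λ a → ι (eqb B (h a) b) * φ a))
      ≡⟨ Σ-cong (enum B) (λ b → sym (Σ-*ˡ L (g b) _)) ⟩
    Σℤ (enum B) (λ b → Σℤ L (λ a → g b * (ι (eqb B (h a) b) * φ a)))
      ≡⟨ Σ-swap (enum B) L _ ⟩
    Σℤ L (λ a → Σℤ (enum B) (λ b → g b * (ι (eqb B (h a) b) * φ a)))
      ≡⟨ Σ-cong L (λ a → Σ-cong (enum B) (λ b → x∙yz≈y∙xz (g b) (ι (eqb B (h a) b)) (φ a))) ⟩
    Σℤ L (λ a → Σℤ (enum B) (λ b → ι (eqb B (h a) b) * (g b * φ a)))
      ≡⟨ Σ-cong L (λ a → Σ-pick B (h a) (λ b → g b * φ a)) ⟩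
    Σℤ L (λ a → g (h a) * φ a) ∎
    where open ≡-Reasoning

effect : (E : FinType) → Quad (Carrier E) → Carrier E → ℤ
effect E t r = + post E t r - + pre E t r

effect-idle : (E : FinType) (a b r : Carrier E) → effect E (a , b , a , b) r ≡ + 0
effect-idle E a b r = ℤₚ.+-inverseʳ (+ pre E (a , b , a , b) r)

+-mass : ∀ {Σ} (P : Protocol Σ) (C : Config P) (R : Subset P) →
         + mass P C R ≡ sumℤ (Q P) (λ q → ι (R q) * + C q)
+-mass P C R = trans (+-sum (enum (Q P)) _) (Σ-cong (enum (Q P)) (λ q → +-if (R q) (C q)))

-- The projection of a conjunction onto a component, abstracted: the transitions
-- selected by Sᵢ act on the image of π, all others are idle there.
module Projection {Σ : Set} (P Pᵢ : Protocol Σ)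
  (π : Carrier (Q P) → Carrier (Q Pᵢ))
  (Sᵢ : Quad (Carrier (Q P)) → Bool)
  (idle : ∀ a b c d → T P (a , b , c , d) ≡ true → Sᵢ (a , b , c , d) ≡ false →
          π a ≡ π c × π b ≡ π d)
  (x : Quad (Carrier (Q P)) → ℕ) (x-transitions : IsTransVec P x)
  where

  private
    E = Q P
    F = Q Pᵢ

  πT : Quad (Carrier E) → Quad (Carrier F)
  πT (a , b , c , d) = (π a , π b , π c , π d)

  πC : Config P → Config Pᵢ
  πC C q = sumF E (λ r → if eqb F (π r) q then C r else 0)

  πX : Quad (Carrier F) → ℕ
  πX t = sumF (QuadF E) (λ s → if Sᵢ s ∧ eqb (QuadF F) (πT s) t then x s else 0)

  module States = Fibres F π (enum E)
  module Transitions = Fibres (QuadF F) πT (enum (QuadF E))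
  open States using (fibreSum; fibreSum-cong; fibreSum-+; fibreSum--)

  xᵢ : Quad (Carrier E) → ℤ
  xᵢ s = ι (Sᵢ s) * + x s

  +-πC : ∀ C q → + πC C q ≡ fibreSum (λ r → + C r) q
  +-πC C q = trans (+-sum (enum E) _) (Σ-cong (enum E) (λ r → +-if (eqb F (π r) q) (C r)))

  +-πX : ∀ t → + πX t ≡ Transitions.fibreSum xᵢ t
  +-πX t = trans (+-sum (enum (QuadF E)) _) (Σ-cong (enum (QuadF E)) summand)
    where
    summand : ∀ s → + (if Sᵢ s ∧ eqb (QuadF F) (πT s) t then x s else 0)
                  ≡ ι (eqb (QuadF F) (πT s) t) * xᵢ s
    summand s = trans (+-if _ (x s))
      (trans (cong (_* + x s) (ι-∧ (Sᵢ s) _)) (xy∙z≈y∙xz (ι (Sᵢ s)) _ (+ x s)))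

  fibreSum-count : ∀ a q → fibreSum (λ r → + count E a r) q ≡ + count F (π a) q
  fibreSum-count a q = trans (Σ-cong (enum E) (λ r → ℤₚ.*-comm (ι (eqb F (π r) q)) _))
                             (Σ-pick E a (λ r → ι (eqb F (π r) q)))

  fibreSum-count₂ : ∀ a b q → fibreSum (λ r → + (count E a r ℕ.+ count E b r)) q
                            ≡ + (count F (π a) q ℕ.+ count F (π b) q)
  fibreSum-count₂ a b q = begin
    fibreSum (λ r → + (count E a r ℕ.+ count E b r)) q
      ≡⟨ fibreSum-cong (λ r → ℤₚ.pos-+ (count E a r) (count E b r)) q ⟩
    fibreSum (λ r → + count E a r + + count E b r) q
      ≡⟨ fibreSum-+ _ _ q ⟩
    fibreSum (λ r → + count E a r) q + fibreSum (λ r → + count E b r) q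
      ≡⟨ cong₂ _+_ (fibreSum-count a q) (fibreSum-count b q) ⟩
    + count F (π a) q + + count F (π b) q
      ≡⟨ ℤₚ.pos-+ (count F (π a) q) (count F (π b) q) ⟨
    + (count F (π a) q ℕ.+ count F (π b) q) ∎
    where open ≡-Reasoning

  fibreSum-effect : ∀ t q → fibreSum (effect E t) q ≡ effect F (πT t) q
  fibreSum-effect (a , b , c , d) q =
    trans (fibreSum-- _ _ q) (cong₂ _-_ (fibreSum-count₂ c d q) (fibreSum-count₂ a b q))

  unselected-effect : ∀ s q → Sᵢ s ≡ false → + x s * effect F (πT s) q ≡ + 0
  unselected-effect s@(a , b , c , d) q unselected with T P s in transition
  ... | false = cong (λ n → + n * effect F (πT s) q) (x-transitions s transition)
  ... | true  = trans (cong (+ x s *_) idle-effect) (ℤₚ.*-zeroʳ (+ x s))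
    where
    idle-effect : effect F (πT s) q ≡ + 0
    idle-effect with idle a b c d transition unselected
    ... | πa≡πc , πb≡πd =
      subst₂ (λ u v → effect F (π a , π b , u , v) q ≡ + 0) πa≡πc πb≡πd
             (effect-idle F (π a) (π b) q)

  xᵢ-effect : ∀ s q → effect F (πT s) q * xᵢ s ≡ + x s * effect F (πT s) q
  xᵢ-effect s q with Sᵢ s in selected
  ... | true  = trans (cong (effect F (πT s) q *_) (ℤₚ.*-identityˡ (+ x s)))
                      (ℤₚ.*-comm (effect F (πT s) q) (+ x s))
  ... | false = trans (ℤₚ.*-zeroʳ (effect F (πT s) q))
                      (sym (unselected-effect s q selected))

  displacement-π : ∀ q → fibreSum (λ r → sumℤ (QuadF E) (λ s → + x s * effect E s r)) q
                       ≡ sumℤ (QuadF F) (λ t → + πX t * effect F t q)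
  displacement-π q = begin
    fibreSum (λ r → Σℤ (enum (QuadF E)) (λ s → + x s * effect E s r)) q
      ≡⟨ States.fibreSum-Σ (enum (QuadF E)) _ q ⟩
    Σℤ (enum (QuadF E)) (λ s → fibreSum (λ r → + x s * effect E s r) q)
      ≡⟨ Σ-cong (enum (QuadF E)) (λ s →
           trans (States.fibreSum-*ˡ (+ x s) _ q) (cong (+ x s *_) (fibreSum-effect s q))) ⟩
    Σℤ (enum (QuadF E)) (λ s → + x s * effect F (πT s) q)
      ≡⟨ Σ-cong (enum (QuadF E)) (λ s → xᵢ-effect s q) ⟨
    Σℤ (enum (QuadF E)) (λ s → effect F (πT s) q * xᵢ s)
      ≡⟨ Transitions.Σ-fibreSum (λ t → effect F t q) xᵢ ⟨
    Σℤ (enum (QuadF F)) (λ t → effect F t q * Transitions.fibreSum xᵢ t)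
      ≡⟨ Σ-cong (enum (QuadF F)) (λ t →
           trans (ℤₚ.*-comm (effect F t q) _) (cong (_* effect F t q) (sym (+-πX t)))) ⟩
    Σℤ (enum (QuadF F)) (λ t → + πX t * effect F t q) ∎
    where open ≡-Reasoning

  flow-π : ∀ {C C'} → FlowEquations P C C' x → FlowEquations Pᵢ (πC C) (πC C') πX
  flow-π {C} {C'} flow q = begin
    + πC C' q                                          ≡⟨ +-πC C' q ⟩
    fibreSum (λ r → + C' r) q                          ≡⟨ fibreSum-cong flow q ⟩
    fibreSum (λ r → + C r + displacement r) q          ≡⟨ fibreSum-+ _ displacement q ⟩
    fibreSum (λ r → + C r) q + fibreSum displacement q
      ≡⟨ cong₂ _+_ (sym (+-πC C q)) (displacement-π q) ⟩
    + πC C q + sumℤ (QuadF F) (λ t → + πX t * effect F t q) ∎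
    where
    open ≡-Reasoning
    displacement : Carrier E → ℤ
    displacement r = sumℤ (QuadF E) (λ s → + x s * effect E s r)

  mass-π : ∀ C R → mass Pᵢ (πC C) R ≡ mass P C (R ∘ π)
  mass-π C R = ℤₚ.+-injective (begin
    + mass Pᵢ (πC C) R
      ≡⟨ +-mass Pᵢ (πC C) R ⟩
    sumℤ F (λ q → ι (R q) * + πC C q)
      ≡⟨ Σ-cong (enum F) (λ q → cong (ι (R q) *_) (+-πC C q)) ⟩
    sumℤ F (λ q → ι (R q) * fibreSum (λ r → + C r) q)
      ≡⟨ States.Σ-fibreSum (ι ∘ R) _ ⟩
    sumℤ E (λ r → ι (R (π r)) * + C r)
      ≡⟨ +-mass P C (R ∘ π) ⟨
    + mass P C (R ∘ π) ∎)
    where open ≡-Reasoning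

  πX-selected : ∀ s → Sᵢ s ≡ true → πX (πT s) ≡ 0 → x s ≡ 0
  πX-selected s selected πX≡0 =
    subst (λ e → (if e then x s else 0) ≡ 0) (cong₂ _∧_ selected (eqb-refl (QuadF F) (πT s)))
          (sum≡0⇒∈≡0 (enum (QuadF E)) _ πX≡0 (complete (QuadF E) s))

  πX-outside-image : ∀ t → (∀ s → πT s ≡ t → x s ≡ 0) → πX t ≡ 0
  πX-outside-image t x≡0 = all≡0⇒sum≡0 (enum (QuadF E)) _ summand
    where
    summand : ∀ s → (if Sᵢ s ∧ eqb (QuadF F) (πT s) t then x s else 0) ≡ 0
    summand s with eqb (QuadF F) (πT s) t in πs=t
    ... | true  = if-zero (Sᵢ s ∧ true) (x≡0 s (eqb-sound (QuadF F) πs=t))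
    ... | false = subst (λ e → (if e then x s else 0) ≡ 0) (sym (∧-zeroʳ (Sᵢ s))) refl

  support-π : ∀ a b c d → InSupp P x (a , b , c , d) →
              InSupp Pᵢ πX (π a , π b , π c , π d) ⊎ (π a ≡ π c × π b ≡ π d)
  support-π a b c d x≢0 with Sᵢ (a , b , c , d) in selected
  ... | true  = inj₁ (x≢0 ∘ πX-selected _ selected)
  ... | false with T P (a , b , c , d) in transition
  ...   | false = ⊥-elim (x≢0 (x-transitions _ transition))
  ...   | true  = inj₂ (idle a b c d transition selected)

  trap-π⁻¹ : ∀ R → IsTrap Pᵢ πX R → IsTrap P x (R ∘ π)
  trap-π⁻¹ R trap (a , b , c , d) pre∈R x≢0 with support-π a b c d x≢0
  ... | inj₁ πX≢0 = trap (π a , π b , π c , π d) pre∈R πX≢0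
  ... | inj₂ (πa≡πc , πb≡πd) =
    ⊎-map (subst (λ u → R u ≡ true) πa≡πc) (subst (λ u → R u ≡ true) πb≡πd) pre∈R

  siphon-π⁻¹ : ∀ R → IsSiphon Pᵢ πX R → IsSiphon P x (R ∘ π)
  siphon-π⁻¹ R siphon (a , b , c , d) post∈R x≢0 with support-π a b c d x≢0
  ... | inj₁ πX≢0 = siphon (π a , π b , π c , π d) post∈R πX≢0
  ... | inj₂ (πa≡πc , πb≡πd) =
    ⊎-map (subst (λ u → R u ≡ true) (sym πa≡πc)) (subst (λ u → R u ≡ true) (sym πb≡πd)) post∈R

  unsupported-π : (Z : Quad (Carrier F) → Set) → (∀ s → Z (πT s) → ¬ InSupp P x s) →
                  ∀ t → Z t → ¬ InSupp Pᵢ πX t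
  unsupported-π Z unsupported t Zt πX≢0 = πX≢0 (πX-outside-image t λ s πs≡t →
    decidable-stable (x s ℕ.≟ 0) (unsupported s (subst Z (sym πs≡t) Zt)))

  potentiallyReachable-π : ∀ {C C'} → PotentiallyReachable P C C' x →
                           PotentiallyReachable Pᵢ (πC C) (πC C') πX
  potentiallyReachable-π {C} {C'} (flow , traps , siphons) =
    flow-π flow ,
    (λ R trap empty → unsupported-π (λ t → _∈•_ Pᵢ t R)
       (traps (R ∘ π) (trap-π⁻¹ R trap) (trans (sym (mass-π C' R)) empty))) ,
    (λ R siphon empty → unsupported-π (λ t → _∈_• Pᵢ t R)
       (siphons (R ∘ π) (siphon-π⁻¹ R siphon) (trans (sym (mass-π C R)) empty)))

module _ {Σ : Set} (P₁ P₂ : Protocol Σ) where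
  open Conj P₁ P₂

  S₂-idle₁ : ∀ a b c d → S₂ (a , b , c , d) ≡ true → proj₁ a ≡ proj₁ c × proj₁ b ≡ proj₁ d
  S₂-idle₁ a b c d s₂
    with ∧-true _ (proj₂ (∧-true (T P₂ (proj₂ a , proj₂ b , proj₂ c , proj₂ d)) s₂))
  ... | a≡c , b≡d = eqb-sound (Q P₁) a≡c , eqb-sound (Q P₁) b≡d

  S₁-idle₂ : ∀ a b c d → S₁ (a , b , c , d) ≡ true → proj₂ a ≡ proj₂ c × proj₂ b ≡ proj₂ d
  S₁-idle₂ a b c d s₁
    with ∧-true _ (proj₂ (∧-true (T P₁ (proj₁ a , proj₁ b , proj₁ c , proj₁ d)) s₁))
  ... | a≡c , b≡d = eqb-sound (Q P₂) a≡c , eqb-sound (Q P₂) b≡d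

  idle₁ : ∀ a b c d → S (a , b , c , d) ≡ true → S₁ (a , b , c , d) ≡ false →
          proj₁ a ≡ proj₁ c × proj₁ b ≡ proj₁ d
  idle₁ a b c d s s₁≡false =
    S₂-idle₁ a b c d (subst (λ e → e ∨ S₂ (a , b , c , d) ≡ true) s₁≡false s)

  idle₂ : ∀ a b c d → S (a , b , c , d) ≡ true → S₂ (a , b , c , d) ≡ false →
          proj₂ a ≡ proj₂ c × proj₂ b ≡ proj₂ d
  idle₂ a b c d s s₂≡false = S₁-idle₂ a b c d
    (trans (sym (∨-identityʳ _)) (subst (λ e → S₁ (a , b , c , d) ∨ e ≡ true) s₂≡false s))

proposition14 : {Σ : Set} (P₁ P₂ : Protocol Σ) →
    let open Conj P₁ P₂ in
    (C C' : Config conj) (x : Quad (Carrier QC) → ℕ) (i : Fin 2) →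
    IsPopulation QC C → IsPopulation QC C' → IsTransVec conj x →
    PotentiallyReachable conj C C' x →
    PotentiallyReachable (comp i) (πConfig i C) (πConfig i C') (πVec i x)
proposition14 P₁ P₂ C C' x zero    _ _ x-transitions =
  Projection.potentiallyReachable-π (Conj.conj P₁ P₂) P₁ proj₁ (Conj.S₁ P₁ P₂)
    (idle₁ P₁ P₂) x x-transitions
proposition14 P₁ P₂ C C' x (suc _) _ _ x-transitions =
  Projection.potentiallyReachable-π (Conj.conj P₁ P₂) P₂ proj₂ (Conj.S₂ P₁ P₂)
    (idle₂ P₁ P₂) x x-transitions
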